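{- Let $D$ be a loose multipartite tournament with partite sets $X_1,\dots,X_k$, and let $u,v$ be two vertices that are adjacent in $C_{1,2}(D)$ and lie in the same partite set, which is not $\{1,2\}$-competing. If $u$ and $v$ are not true twins in $C_{1,2}(D)$ and $N^+(u)\cup N^+(v)\subseteq X_i$ for some $i\in\{1,\dots,k\}$, then every vertex of $X_i$ is adjacent in $C_{1,2}(D)$ to at least one of $u$ and $v$.
   Context: All graphs and digraphs are finite and simple. For a digraph $D$ and vertex $v$, $N^+(v)$ is its out-neighborhood; $d_D(x,y)$ is the length of a shortest directed path from $x$ to $y$. The $(1,2)$-step competition graph $C_{1,2}(D)$ is the graph on $V(D)$ in which distinct $u,v$ are adjacent iff there is a vertex $w\notin\{u,v\}$ with either $d_{D-v}(u,w)\le 1$ and $d_{D-u}(v,w)\le 2$, or $d_{D-u}(v,w)\le 1$ and $d_{D-v}(u,w)\le 2$. A multipartite tournament is an orientation of a complete $k$-partite graph for some $k\ge3$ (with nonempty partite sets). A set of vertices is $\{1,2\}$-competing if it is a clique in $C_{1,2}(D)$. A multipartite tournament is loose if some partite set is not $\{1,2\}$-competing. Two vertices of a graph are true twins if they have the same closed neighborhood. -}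

module Defs where

open import Data.Nat using (ℕ; _≤_)
open import Data.Fin using (Fin)
open import Data.Product using (Σ; ∃; ∃-syntax; _×_; _,_)
open import Data.Sum using (_⊎_)
open import Data.Empty using (⊥)
open import Relation.Nullary using (¬_)
open import Relation.Binary.PropositionalEquality using (_≡_; _≢_)
open import Function.Bundles using (_⇔_)

record Digraph (n : ℕ) : Set₁ where
  field
    Arc : Fin n → Fin n → Set

open Digraph public

-- Multipartite tournament: an orientation of a complete k-partite graph, k ≥ 3,
-- with nonempty partite sets X_j = { v | part v ≡ j }.
record MultipartiteTournament (n : ℕ) : Set₁ where
  field
    D        : Digraph n
    k        : ℕ
    3≤k      : 3 ≤ k
    part     : Fin n → Fin k
    nonempty : (j : Fin k) → ∃[ v ] part v ≡ j
    noArcIn  : ∀ u v → part u ≡ part v → ¬ Arc D u v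
    oriented : ∀ u v → part u ≢ part v → Arc D u v ⊎ Arc D v u
    asym     : ∀ u v → Arc D u v → ¬ Arc D v u

open MultipartiteTournament public

module _ {n : ℕ} (G : Digraph n) where
  -- d_{G - z}(a , b) ≤ 1   (for a , b ≠ z)
  dist≤1-avoid : Fin n → Fin n → Fin n → Set
  dist≤1-avoid z a b = a ≡ b ⊎ Arc G a b

  -- d_{G - z}(a , b) ≤ 2   (for a , b ≠ z): the intermediate vertex avoids z
  dist≤2-avoid : Fin n → Fin n → Fin n → Set
  dist≤2-avoid z a b =
    dist≤1-avoid z a b ⊎ (∃[ x ] (x ≢ z × Arc G a x × Arc G x b))

  C12 : Fin n → Fin n → Set
  C12 u v = u ≢ v × ∃[ w ] (w ≢ u × w ≢ v ×
      ((dist≤1-avoid v u w × dist≤2-avoid u v w)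
     ⊎ (dist≤1-avoid u v w × dist≤2-avoid v u w)))

  Competing12 : (Fin n → Set) → Set
  Competing12 S = ∀ a b → S a → S b → a ≢ b → C12 a b

  ClosedNbhd : Fin n → Fin n → Set
  ClosedNbhd u w = w ≡ u ⊎ C12 u w

  TrueTwins : Fin n → Fin n → Set
  TrueTwins u v = ∀ w → ClosedNbhd u w ⇔ ClosedNbhd v w

PartiteSet : ∀ {n} (T : MultipartiteTournament n) → Fin (k T) → Fin n → Set
PartiteSet T j v = part T v ≡ j

Loose : ∀ {n} → MultipartiteTournament n → Set
Loose T = ∃[ j ] ¬ Competing12 (D T) (PartiteSet T j)

{-# OPTIONS --safe #-}
module Submission where

-- Some vertex w of X_i is a common out-neighbour of u and v: a C_{1,2}-witness
-- reached in two steps would need an arc inside X_i. Let x ∈ X_i. If x → u then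
-- x → u → w and v → w make x, v compete (symmetrically for x → v). Otherwise
-- u → x and v → x. A sink x would be a common prey of the whole partite set of u,
-- making it {1,2}-competing; so x → s for some s. If u has an out-neighbour
-- t ≠ x (necessarily t ∈ X_i), then s and t are joined by an arc, and either
-- orientation makes x and u compete; likewise for v. In the remaining case x is
-- the sole out-neighbour of both u and v, and then u and v are true twins.

open import Defs
open import Data.Nat using (ℕ)
open import Data.Fin using (Fin)
open import Data.Fin.Properties using (_≟_; any?)
open import Data.Product using (∃-syntax; _×_; _,_; proj₁)
open import Data.Sum using (_⊎_; inj₁; inj₂)
open import Data.Empty using (⊥-elim)
open import Function using (_∘_)
open import Function.Bundles using (mk⇔)
open import Relation.Nullary using (¬_; Dec; yes; no; _×-dec_; ¬?)
open import Relation.Nullary.Decidable using (decidable-stable)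
open import Relation.Binary.PropositionalEquality using (_≡_; _≢_; refl; sym; trans)

C12-sym : ∀ {n} (G : Digraph n) {a b} → C12 G a b → C12 G b a
C12-sym G (a≢b , t , t≢a , t≢b , inj₁ p) = a≢b ∘ sym , t , t≢b , t≢a , inj₂ p
C12-sym G (a≢b , t , t≢a , t≢b , inj₂ p) = a≢b ∘ sym , t , t≢b , t≢a , inj₁ p

module _ {n : ℕ} (T : MultipartiteTournament n) where

  private
    G : Digraph n
    G = D T

    infix 4 _⟶_
    _⟶_ : Fin n → Fin n → Set
    _⟶_ = Arc G

  OutNeighboursIn : Fin n → Fin (k T) → Set
  OutNeighboursIn a j = ∀ t → a ⟶ t → part T t ≡ j

  SoleOutNeighbour : Fin n → Fin n → Set
  SoleOutNeighbour a x = a ⟶ x × (∀ t → a ⟶ t → t ≡ x)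

  arc? : ∀ a b → Dec (a ⟶ b)
  arc? a b with part T a ≟ part T b
  ... | yes same = no (noArcIn T a b same)
  ... | no differ with oriented T a b differ
  ...   | inj₁ a⟶b = yes a⟶b
  ...   | inj₂ b⟶a = no (asym T b a b⟶a)

  arc⇒part≢ : ∀ {a b} → a ⟶ b → part T a ≢ part T b
  arc⇒part≢ {a} {b} a⟶b same = noArcIn T a b same a⟶b

  OutNeighboursIn⇒part≢ : ∀ {a b j} → OutNeighboursIn a j → a ⟶ b → part T a ≢ j
  OutNeighboursIn⇒part≢ {b = b} outA a⟶b pa≡j = arc⇒part≢ a⟶b (trans pa≡j (sym (outA b a⟶b)))

  arc⇒≢ : ∀ {a b} → a ⟶ b → a ≢ b
  arc⇒≢ a⟶b refl = arc⇒part≢ a⟶b refl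

  private
    witness⇒common-out-neighbour : ∀ {a b t j} → t ≢ a → t ≢ b →
                                   OutNeighboursIn a j → OutNeighboursIn b j →
                                   dist≤1-avoid G b a t → dist≤2-avoid G a b t →
                                   a ⟶ t × b ⟶ t
    witness⇒common-out-neighbour t≢a _ _ _ (inj₁ a≡t) _ = ⊥-elim (t≢a (sym a≡t))
    witness⇒common-out-neighbour _ t≢b _ _ (inj₂ _) (inj₁ (inj₁ b≡t)) = ⊥-elim (t≢b (sym b≡t))
    witness⇒common-out-neighbour _ _ _ _ (inj₂ a⟶t) (inj₁ (inj₂ b⟶t)) = a⟶t , b⟶t
    witness⇒common-out-neighbour {t = t} _ _ outA outB (inj₂ a⟶t) (inj₂ (y , _ , b⟶y , y⟶t)) =
      ⊥-elim (arc⇒part≢ y⟶t (trans (outB y b⟶y) (sym (outA t a⟶t))))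

  C12⇒common-out-neighbour : ∀ {u v j} → OutNeighboursIn u j → OutNeighboursIn v j →
                             C12 G u v → ∃[ w ] (u ⟶ w × v ⟶ w)
  C12⇒common-out-neighbour outU outV (_ , t , t≢u , t≢v , inj₁ (d₁ , d₂)) =
    t , witness⇒common-out-neighbour t≢u t≢v outU outV d₁ d₂
  C12⇒common-out-neighbour outU outV (_ , t , t≢u , t≢v , inj₂ (d₁ , d₂))
    with v⟶t , u⟶t ← witness⇒common-out-neighbour t≢v t≢u outV outU d₁ d₂ = t , u⟶t , v⟶t

  C12-of-in-neighbour : ∀ {x u v w} → part T u ≡ part T v → u ≢ v →
                        x ⟶ u → u ⟶ w → v ⟶ w → C12 G x v
  C12-of-in-neighbour {x} {u} {v} {w} pu≡pv u≢v x⟶u u⟶w v⟶w =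
    x≢v , w , w≢x , arc⇒≢ v⟶w ∘ sym , inj₂ (inj₂ v⟶w , inj₂ (u , u≢v , x⟶u , u⟶w))
    where
    x≢v : x ≢ v
    x≢v refl = arc⇒part≢ x⟶u (sym pu≡pv)
    w≢x : w ≢ x
    w≢x refl = asym T x u x⟶u u⟶w

  C12-of-out-neighbour : ∀ {x s u t} → u ⟶ x → x ⟶ s → u ⟶ t → t ≢ x →
                         part T t ≡ part T x → C12 G x u
  C12-of-out-neighbour {x} {s} {u} {t} u⟶x x⟶s u⟶t t≢x pt≡px =
    compete (oriented T s t (λ ps≡pt → arc⇒part≢ x⟶s (trans (sym pt≡px) (sym ps≡pt))))
    where
    x≢u : x ≢ u
    x≢u = arc⇒≢ u⟶x ∘ sym
    s≢u : s ≢ u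
    s≢u refl = asym T u x u⟶x x⟶s
    compete : s ⟶ t ⊎ t ⟶ s → C12 G x u
    compete (inj₁ s⟶t) = x≢u , t , t≢x , arc⇒≢ u⟶t ∘ sym ,
                         inj₂ (inj₂ u⟶t , inj₂ (s , s≢u , x⟶s , s⟶t))
    compete (inj₂ t⟶s) = x≢u , s , arc⇒≢ x⟶s ∘ sym , s≢u ,
                         inj₁ (inj₂ x⟶s , inj₂ (t , t≢x , u⟶t , t⟶s))

  C12⊎SoleOutNeighbour : ∀ {u x s} → u ⟶ x → x ⟶ s → OutNeighboursIn u (part T x) →
                         C12 G x u ⊎ SoleOutNeighbour u x
  C12⊎SoleOutNeighbour {u} {x} u⟶x x⟶s outU with any? (λ t → arc? u t ×-dec ¬? (t ≟ x))
  ... | yes (t , u⟶t , t≢x) = inj₁ (C12-of-out-neighbour u⟶x x⟶s u⟶t t≢x (outU t u⟶t))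
  ... | no ∄t = inj₂ (u⟶x , λ t u⟶t → decidable-stable (t ≟ x) (λ t≢x → ∄t (t , u⟶t , t≢x)))

  common-out-neighbour⇒Competing12 : ∀ {x} (S : Fin n → Set) → (∀ a → S a → a ⟶ x) →
                                     Competing12 G S
  common-out-neighbour⇒Competing12 {x} S into a b a∈S b∈S a≢b =
    a≢b , x , arc⇒≢ a⟶x ∘ sym , arc⇒≢ b⟶x ∘ sym , inj₁ (inj₂ a⟶x , inj₁ (inj₂ b⟶x))
    where
    a⟶x = into a a∈S
    b⟶x = into b b∈S

  sink⇒Competing12 : ∀ {x j} → ¬ (∃[ s ] x ⟶ s) → j ≢ part T x → Competing12 G (PartiteSet T j)
  sink⇒Competing12 {x} {j} sink x∉Xj = common-out-neighbour⇒Competing12 (PartiteSet T j) into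
    where
    into : ∀ a → part T a ≡ j → a ⟶ x
    into a a∈Xj with oriented T a x (λ pa≡px → x∉Xj (trans (sym a∈Xj) pa≡px))
    ... | inj₁ a⟶x = a⟶x
    ... | inj₂ x⟶a = ⊥-elim (sink (a , x⟶a))

  dist≤2-avoid-exchange : ∀ {u v x z} → u ≢ v → part T u ≡ part T v → SoleOutNeighbour u x →
                          dist≤2-avoid G u z x → dist≤2-avoid G v z x
  dist≤2-avoid-exchange _ _ _ (inj₁ z≤₁x) = inj₁ z≤₁x
  dist≤2-avoid-exchange {u} {v} {z = z} u≢v pu≡pv (u⟶x , onlyX) (inj₂ (y , _ , z⟶y , y⟶x))
    with y ≟ v
  ... | no y≢v = inj₂ (y , y≢v , z⟶y , y⟶x)
  ... | yes refl with oriented T z u (λ pz≡pu → arc⇒part≢ z⟶y (trans pz≡pu pu≡pv))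
  ...   | inj₁ z⟶u = inj₂ (u , u≢v , z⟶u , u⟶x)
  ...   | inj₂ u⟶z with onlyX z u⟶z
  ...     | refl = ⊥-elim (asym T z y z⟶y y⟶x)

  C12-exchange : ∀ {u v x z} → u ≢ v → part T u ≡ part T v → SoleOutNeighbour u x → v ⟶ x →
                 v ≢ z → C12 G u z → C12 G v z
  C12-exchange _ _ _ _ _ (_ , t , t≢u , _ , inj₁ (inj₁ u≡t , _)) = ⊥-elim (t≢u (sym u≡t))
  C12-exchange u≢v pu≡pv sole@(_ , onlyX) v⟶x v≢z
               (_ , t , _ , t≢z , inj₁ (inj₂ u⟶t , z≤₂t)) with onlyX t u⟶t
  ... | refl = v≢z , t , arc⇒≢ v⟶x ∘ sym , t≢z ,
               inj₁ (inj₂ v⟶x , dist≤2-avoid-exchange u≢v pu≡pv sole z≤₂t)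
  C12-exchange _ _ _ _ _ (_ , t , _ , t≢z , inj₂ (inj₁ z≡t , _)) = ⊥-elim (t≢z (sym z≡t))
  C12-exchange _ _ _ _ _ (_ , t , t≢u , _ , inj₂ (inj₂ _ , inj₁ (inj₁ u≡t))) =
    ⊥-elim (t≢u (sym u≡t))
  C12-exchange _ _ (_ , onlyX) v⟶x v≢z
               (_ , t , _ , t≢z , inj₂ (inj₂ z⟶t , inj₁ (inj₂ u⟶t))) with onlyX t u⟶t
  ... | refl = v≢z , t , arc⇒≢ v⟶x ∘ sym , t≢z , inj₂ (inj₂ z⟶t , inj₁ (inj₂ v⟶x))
  C12-exchange {v = v} _ _ (_ , onlyX) v⟶x v≢z
               (_ , t , _ , t≢z , inj₂ (inj₂ z⟶t , inj₂ (y , y≢z , u⟶y , y⟶t))) with onlyX y u⟶y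
  ... | refl = v≢z , t , (λ { refl → asym T v y v⟶x y⟶t }) , t≢z ,
               inj₂ (inj₂ z⟶t , inj₂ (y , y≢z , v⟶x , y⟶t))

  SoleOutNeighbour⇒TrueTwins : ∀ {u v x} → part T u ≡ part T v → C12 G u v →
                               SoleOutNeighbour u x → SoleOutNeighbour v x → TrueTwins G u v
  SoleOutNeighbour⇒TrueTwins {x = x} pu≡pv u~v soleU soleV w =
    mk⇔ (exchange pu≡pv u~v soleU (proj₁ soleV))
        (exchange (sym pu≡pv) (C12-sym G u~v) soleV (proj₁ soleU))
    where
    exchange : ∀ {a b} → part T a ≡ part T b → C12 G a b → SoleOutNeighbour a x → b ⟶ x →
               ClosedNbhd G a w → ClosedNbhd G b w
    exchange _ a~b _ _ (inj₁ refl) = inj₂ (C12-sym G a~b)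
    exchange {b = b} pa≡pb a~b soleA b⟶x (inj₂ a~w) with b ≟ w
    ... | yes b≡w = inj₁ (sym b≡w)
    ... | no b≢w = inj₂ (C12-exchange (proj₁ a~b) pa≡pb soleA b⟶x b≢w a~w)

  C12-of-common-out-neighbour : ∀ {u v x} → part T u ≡ part T v → C12 G u v →
                                ¬ Competing12 G (PartiteSet T (part T u)) → ¬ TrueTwins G u v →
                                OutNeighboursIn u (part T x) → OutNeighboursIn v (part T x) →
                                u ⟶ x → v ⟶ x → C12 G x u ⊎ C12 G x v
  C12-of-common-out-neighbour {x = x} pu≡pv u~v ¬competing ¬twins outU outV u⟶x v⟶x
    with any? (arc? x)
  ... | no sink = ⊥-elim (¬competing (sink⇒Competing12 sink (OutNeighboursIn⇒part≢ outU u⟶x)))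
  ... | yes (s , x⟶s) with C12⊎SoleOutNeighbour u⟶x x⟶s outU | C12⊎SoleOutNeighbour v⟶x x⟶s outV
  ...   | inj₁ x~u | _ = inj₁ x~u
  ...   | _ | inj₁ x~v = inj₂ x~v
  ...   | inj₂ soleU | inj₂ soleV =
          ⊥-elim (¬twins (SoleOutNeighbour⇒TrueTwins pu≡pv u~v soleU soleV))

lemma4p3 : ∀ {n} (T : MultipartiteTournament n) → Loose T →
    (u v : Fin n) → C12 (D T) u v →
    part T u ≡ part T v →
    ¬ Competing12 (D T) (PartiteSet T (part T u)) →
    ¬ TrueTwins (D T) u v →
    (i : Fin (k T)) →
    (∀ w → Arc (D T) u w ⊎ Arc (D T) v w → PartiteSet T i w) →
    ∀ x → PartiteSet T i x → C12 (D T) x u ⊎ C12 (D T) x v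
lemma4p3 T _ u v u~v pu≡pv ¬competing ¬twins .(part T x) out x refl
  with outU ← (λ t → out t ∘ inj₁) | outV ← (λ t → out t ∘ inj₂)
  with w , u⟶w , v⟶w ← C12⇒common-out-neighbour T outU outV u~v
  with oriented T u x (OutNeighboursIn⇒part≢ T outU u⟶w)
     | oriented T v x (OutNeighboursIn⇒part≢ T outV v⟶w)
... | inj₂ x⟶u | _ = inj₂ (C12-of-in-neighbour T pu≡pv (proj₁ u~v) x⟶u u⟶w v⟶w)
... | _ | inj₂ x⟶v = inj₁ (C12-of-in-neighbour T (sym pu≡pv) (proj₁ u~v ∘ sym) x⟶v v⟶w u⟶w)
... | inj₁ u⟶x | inj₁ v⟶x =
      C12-of-common-out-neighbour T pu≡pv u~v ¬competing ¬twins outU outV u⟶x v⟶x
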